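{- Let $G$ be the infinite grid graph with vertex set $\mathbb{Z}^2$, $\sigma$ a distinguished face, and $k$ a nonnegative integer. Let $K$ be the face configuration with $K_\sigma=k$ and $K_\tau=0$ for all faces $\tau\ne\sigma$. Then for any configuration $K^*$ reachable from $K$ by the flow-firing process for $(G,\sigma)$ in the face representation: (1) $K^*_\tau\ge 0$ for every face $\tau$; (2) the total $\sum_\tau K^*_\tau$ is bounded (uniformly over all reachable configurations) and is non-decreasing along any run of the process.
   Context: Faces of $G$ are the unit squares of $\mathbb{Z}^2$; two faces are neighbors if they share an edge. A face configuration assigns an integer $F_\tau$ to each face. Flow-firing process for $(G,\sigma)$ in the face representation: at each step choose two neighboring faces $a,b$, and: if $a\neq\sigma$, $b\neq\sigma$ and $F_a\ge F_b+2$, replace $F_a$ by $F_a-1$ and $F_b$ by $F_b+1$; if $b=\sigma$ and $F_\sigma>F_a$, replace $F_a$ by $F_a+1$; if $b=\sigma$ and $F_\sigma<F_a$, replace $F_a$ by $F_a-1$. No other moves are allowed. -}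

module Defs where

open import Data.Nat using (ℕ)
open import Data.Integer using (ℤ; +_; _+_; _-_; _≤_; _<_; ∣_∣)
import Data.Integer as ℤ
open import Data.Integer.Properties using () renaming (_≟_ to _≟ℤ_)
open import Data.Product using (_×_; _,_; Σ; ∃)
open import Data.Product.Properties using (≡-dec)
open import Data.List using (List; map; foldr)
open import Data.List.Membership.Propositional using (_∈_)
open import Data.List.Relation.Unary.Unique.Propositional using (Unique)
open import Relation.Binary.PropositionalEquality using (_≡_; _≢_)
open import Relation.Binary.Construct.Closure.ReflexiveTransitive using (Star)
open import Relation.Nullary using (does)
open import Data.Bool using (if_then_else_)
import Data.Nat as ℕ

-- Faces of the grid graph on ℤ², indexed by their lower-left corner.
Face : Set
Face = ℤ × ℤ

_≟F_ : (a b : Face) → Relation.Nullary.Dec (a ≡ b)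
_≟F_ = ≡-dec _≟ℤ_ _≟ℤ_

Adj : Face → Face → Set
Adj (x , y) (x' , y') = ∣ x - x' ∣ ℕ.+ ∣ y - y' ∣ ≡ 1

Config : Set
Config = Face → ℤ

bump : Config → Face → ℤ → Config
bump F a δ τ = if does (τ ≟F a) then F τ + δ else F τ

data Step (σ : Face) (F : Config) : Config → Set where
  fire : (a b : Face) → Adj a b → a ≢ σ → b ≢ σ → F b + + 2 ≤ F a →
         Step σ F (bump (bump F a (ℤ.- + 1)) b (+ 1))
  fromσ : (a : Face) → Adj a σ → F a < F σ → Step σ F (bump F a (+ 1))
  toσ   : (a : Face) → Adj a σ → F σ < F a → Step σ F (bump F a (ℤ.- + 1))

Reachable : Face → Config → Config → Set
Reachable σ = Star (Step σ)

initial : Face → ℕ → Config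
initial σ k τ = if does (τ ≟F σ) then + k else + 0

sumℤ : List ℤ → ℤ
sumℤ = foldr _+_ (+ 0)

-- `Total F s`: F has finite support and the sum of F over all faces is s,
-- witnessed by a duplicate-free list of faces containing the support.
Total : Config → ℤ → Set
Total F s = Σ (List Face) λ L →
  Unique L × (∀ τ → F τ ≢ + 0 → τ ∈ L) × (sumℤ (map F L) ≡ s)

module Submission where

-- Starting from k chips on σ, every reachable configuration F
-- satisfies an invariant: F σ = k, and every face τ carries a natural number
-- m ≤ k which is either 0 or satisfies dist(τ,σ) + m ≤ k + 1, i.e. the values
-- decay by at least one per unit of grid distance from σ.  The invariant
-- survives each move: when a fires into b we have F a ≥ F b + 2, so b, at most
-- one step further from σ than a, receives F b + 1 ≤ F a - 1; σ only feeds
-- neighbours below k; and a move towards σ would need a neighbour above k.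
--
-- The theorem follows:
-- nonnegativity and existence of the total come from the invariant and the box,
-- the uniform bound is k times the size of the box, and monotonicity holds
-- because the invariant forbids the only move with negative gain.

open import Defs
open import Data.Nat using (ℕ)
open import Data.Integer using (ℤ; +_; _≤_)
open import Data.Product using (_×_; Σ; ∃)

import Data.Nat as N
open N using (zero; suc; z≤n; s≤s)
import Data.Nat.Properties as NP
open import Data.Integer using (-[1+_]; ∣_∣; _-_; -_; _+_; +≤+; +<+; _<_)
import Data.Integer.Properties as ZP
open import Data.Integer.Tactic.RingSolver using (solve-∀)
open import Algebra.Properties.CommutativeSemigroup NP.+-commutativeSemigroup
  using (interchange)
open import Algebra.Properties.CommutativeSemigroup ZP.+-commutativeSemigroup
  using (x∙yz≈y∙xz; xy∙z≈xz∙y)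
open import Data.Product using (_,_)
open import Data.Sum using (inj₁; inj₂)
open import Data.List using (List; []; _∷_; _++_; map; length; deduplicate; cartesianProduct)
open import Data.List.Membership.Propositional using (_∈_)
open import Data.List.Membership.Propositional.Properties
  using (∈-∃++; ∈-++⁻; ∈-++⁺ˡ; ∈-++⁺ʳ; ∈-map⁺; ∈-deduplicate⁺; ∈-cartesianProduct⁺)
open import Data.List.Membership.DecPropositional _≟F_ using (_∈?_)
open import Data.List.Relation.Unary.Any using (here; there)
open import Data.List.Relation.Unary.All as All using (All; []; _∷_)
open import Data.List.Relation.Unary.All.Properties using (¬Any⇒All¬)
open import Data.List.Relation.Unary.AllPairs using (_∷_)
open import Data.List.Relation.Unary.Unique.Propositional using (Unique)
open import Data.List.Relation.Unary.Unique.DecPropositional.Properties _≟F_ using (deduplicate-!)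
open import Relation.Binary.PropositionalEquality
open import Relation.Binary.Construct.Closure.ReflexiveTransitive using (Star; ε; _◅_)
open import Relation.Nullary using (yes; no; ¬_; contradiction)

-- ℓ¹ distance between faces; `Adj a b` unfolds to `dist a b ≡ 1`.
dist : Face → Face → ℕ
dist (x , y) (x' , y') = ∣ x - x' ∣ N.+ ∣ y - y' ∣

dist-self : ∀ a → dist a a ≡ 0
dist-self (x , y) = cong₂ N._+_ (cong ∣_∣ (ZP.+-inverseʳ x)) (cong ∣_∣ (ZP.+-inverseʳ y))

dist-sym : ∀ a b → dist a b ≡ dist b a
dist-sym (x , y) (x' , y') = cong₂ N._+_ (ZP.∣i-j∣≡∣j-i∣ x x') (ZP.∣i-j∣≡∣j-i∣ y y')

∣-∣-triangle : ∀ x y z → ∣ x - z ∣ N.≤ ∣ x - y ∣ N.+ ∣ y - z ∣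
∣-∣-triangle x y z =
  subst (λ w → ∣ w ∣ N.≤ ∣ x - y ∣ N.+ ∣ y - z ∣) (sym (split x y z))
        (ZP.∣i+j∣≤∣i∣+∣j∣ (x - y) (y - z))
  where
  split : ∀ x y z → x - z ≡ (x - y) + (y - z)
  split = solve-∀

dist-triangle : ∀ a b c → dist a c N.≤ dist a b N.+ dist b c
dist-triangle (xa , ya) (xb , yb) (xc , yc) = begin
  ∣ xa - xc ∣ N.+ ∣ ya - yc ∣
    ≤⟨ NP.+-mono-≤ (∣-∣-triangle xa xb xc) (∣-∣-triangle ya yb yc) ⟩
  (∣ xa - xb ∣ N.+ ∣ xb - xc ∣) N.+ (∣ ya - yb ∣ N.+ ∣ yb - yc ∣)
    ≡⟨ interchange (∣ xa - xb ∣) (∣ xb - xc ∣) (∣ ya - yb ∣) (∣ yb - yc ∣) ⟩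
  (∣ xa - xb ∣ N.+ ∣ ya - yb ∣) N.+ (∣ xb - xc ∣ N.+ ∣ yb - yc ∣) ∎
  where open NP.≤-Reasoning

dist-adj : ∀ a b c → Adj a b → dist b c N.≤ suc (dist a c)
dist-adj a b c adj = begin
  dist b c               ≤⟨ dist-triangle b a c ⟩
  dist b a N.+ dist a c  ≡⟨ cong (N._+ dist a c) (trans (dist-sym b a) adj) ⟩
  suc (dist a c)         ∎
  where open NP.≤-Reasoning

adj⇒≢ : ∀ a b → Adj a b → a ≢ b
adj⇒≢ a .a adj refl with trans (sym (dist-self a)) adj
... | ()

bump-here : ∀ F a δ → bump F a δ a ≡ F a + δ
bump-here F a δ with a ≟F a
... | yes _  = refl
... | no a≢a = contradiction refl a≢a

bump-there : ∀ F a δ τ → τ ≢ a → bump F a δ τ ≡ F τ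
bump-there F a δ τ τ≢a with τ ≟F a
... | yes τ≡a = contradiction τ≡a τ≢a
... | no _    = refl

bump-pointwise : ∀ (P : Face → ℤ → Set) F a δ → P a (F a + δ) →
                 (∀ τ → τ ≢ a → P τ (F τ)) → ∀ τ → P τ (bump F a δ τ)
bump-pointwise P F a δ at-a elsewhere τ with τ ≟F a
... | yes refl = at-a
... | no τ≢a   = elsewhere τ τ≢a

sumOver : List Face → Config → ℤ
sumOver L F = sumℤ (map F L)

sumOver-++ : ∀ xs ys F → sumOver (xs ++ ys) F ≡ sumOver xs F + sumOver ys F
sumOver-++ []       ys F = sym (ZP.+-identityˡ (sumOver ys F))
sumOver-++ (x ∷ xs) ys F =
  trans (cong (λ w → F x + w) (sumOver-++ xs ys F)) (sym (ZP.+-assoc (F x) _ _))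

sumOver-nonneg : ∀ {F} → (∀ τ → + 0 ≤ F τ) → ∀ L → + 0 ≤ sumOver L F
sumOver-nonneg nn []      = +≤+ z≤n
sumOver-nonneg nn (x ∷ L) = ZP.+-mono-≤ (nn x) (sumOver-nonneg nn L)

sumOver-bounded : ∀ {F} k → (∀ τ → F τ ≤ + k) → ∀ L → sumOver L F ≤ + (k N.* length L)
sumOver-bounded k up []      = ZP.≤-reflexive (cong +_ (sym (NP.*-zeroʳ k)))
sumOver-bounded {F} k up (x ∷ L) = begin
  F x + sumOver L F          ≤⟨ ZP.+-mono-≤ (up x) (sumOver-bounded k up L) ⟩
  + k + + (k N.* length L)    ≡⟨ cong +_ (sym (NP.*-suc k (length L))) ⟩
  + (k N.* suc (length L))    ∎
  where open ZP.≤-Reasoning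

sumOver-≤ : ∀ {F} → (∀ τ → + 0 ≤ F τ) → ∀ {L} → Unique L → ∀ M →
            (∀ τ → τ ∈ L → F τ ≢ + 0 → τ ∈ M) → sumOver L F ≤ sumOver M F
sumOver-≤ nn {[]} _ M _ = sumOver-nonneg nn M
sumOver-≤ {F} nn {x ∷ L} (x∉L ∷ uL) M cov with F x ZP.≟ + 0
... | yes Fx≡0 = begin
  F x + sumOver L F  ≡⟨ cong (_+ sumOver L F) Fx≡0 ⟩
  + 0 + sumOver L F  ≡⟨ ZP.+-identityˡ (sumOver L F) ⟩
  sumOver L F        ≤⟨ sumOver-≤ nn uL M (λ τ τ∈L → cov τ (there τ∈L)) ⟩
  sumOver M F        ∎
  where open ZP.≤-Reasoning
... | no Fx≢0 with ∈-∃++ (cov x (here refl) Fx≢0)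
...   | ys , zs , refl = begin
  F x + sumOver L F                  ≤⟨ ZP.+-monoʳ-≤ (F x) (sumOver-≤ nn uL (ys ++ zs) cover-rest) ⟩
  F x + sumOver (ys ++ zs) F         ≡⟨ cong (λ w → F x + w) (sumOver-++ ys zs F) ⟩
  F x + (sumOver ys F + sumOver zs F) ≡⟨ x∙yz≈y∙xz (F x) (sumOver ys F) (sumOver zs F) ⟩
  sumOver ys F + (F x + sumOver zs F) ≡⟨ sumOver-++ ys (x ∷ zs) F ⟨
  sumOver (ys ++ x ∷ zs) F           ∎
  where
  open ZP.≤-Reasoning
  -- Faces of L avoid x, so they survive the removal of x from M.
  cover-rest : ∀ τ → τ ∈ L → F τ ≢ + 0 → τ ∈ ys ++ zs
  cover-rest τ τ∈L Fτ≢0 with ∈-++⁻ ys (cov τ (there τ∈L) Fτ≢0)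
  ... | inj₁ τ∈ys         = ∈-++⁺ˡ τ∈ys
  ... | inj₂ (here τ≡x)   = contradiction (sym τ≡x) (All.lookup x∉L τ∈L)
  ... | inj₂ (there τ∈zs) = ∈-++⁺ʳ ys τ∈zs

TotalOn : List Face → Config → ℤ → Set
TotalOn L F s = Unique L × (∀ τ → F τ ≢ + 0 → τ ∈ L) × (sumOver L F ≡ s)

total-unique : ∀ {F s t} → (∀ τ → + 0 ≤ F τ) → Total F s → Total F t → s ≡ t
total-unique nn (L , uL , coverL , refl) (M , uM , coverM , refl) =
  ZP.≤-antisym (sumOver-≤ nn uL M (λ τ _ → coverM τ)) (sumOver-≤ nn uM L (λ τ _ → coverL τ))

total-containing : ∀ {F s} a → Total F s → Σ (List Face) λ L → a ∈ L × TotalOn L F s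
total-containing {F} {s} a (L , uL , cover , sum≡s) with a ∈? L
... | yes a∈L = L , a∈L , uL , cover , sum≡s
... | no  a∉L = a ∷ L , here refl , ¬Any⇒All¬ L a∉L ∷ uL , (λ τ Fτ≢0 → there (cover τ Fτ≢0)) , sum≡s′
  where
  Fa≡0 : F a ≡ + 0
  Fa≡0 with F a ZP.≟ + 0
  ... | yes Fa≡0 = Fa≡0
  ... | no  Fa≢0 = contradiction (cover a Fa≢0) a∉L
  sum≡s′ : F a + sumOver L F ≡ s
  sum≡s′ = trans (cong (_+ sumOver L F) Fa≡0) (trans (ZP.+-identityˡ _) sum≡s)

sumOver-bump-absent : ∀ F a δ L → All (a ≢_) L → sumOver L (bump F a δ) ≡ sumOver L F
sumOver-bump-absent F a δ []      []           = refl
sumOver-bump-absent F a δ (x ∷ L) (a≢x ∷ a∉L) =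
  cong₂ _+_ (bump-there F a δ x (≢-sym a≢x)) (sumOver-bump-absent F a δ L a∉L)

sumOver-bump : ∀ F a δ {L} → Unique L → a ∈ L → sumOver L (bump F a δ) ≡ sumOver L F + δ
sumOver-bump F a δ {a ∷ L} (a∉L ∷ _) (here refl) = begin
  bump F a δ a + sumOver L (bump F a δ) ≡⟨ cong₂ _+_ (bump-here F a δ) (sumOver-bump-absent F a δ L a∉L) ⟩
  (F a + δ) + sumOver L F               ≡⟨ xy∙z≈xz∙y (F a) δ (sumOver L F) ⟩
  (F a + sumOver L F) + δ               ∎
  where open ≡-Reasoning
sumOver-bump F a δ {x ∷ L} (x∉L ∷ uL) (there a∈L) = begin
  bump F a δ x + sumOver L (bump F a δ) ≡⟨ cong₂ _+_ (bump-there F a δ x (λ x≡a → All.lookup x∉L a∈L x≡a))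
                                                      (sumOver-bump F a δ uL a∈L) ⟩
  F x + (sumOver L F + δ)               ≡⟨ ZP.+-assoc (F x) (sumOver L F) δ ⟨
  (F x + sumOver L F) + δ               ∎
  where open ≡-Reasoning

total-bump : ∀ {F s} a δ → Total F s → Total (bump F a δ) (s + δ)
total-bump {F} {s} a δ t with total-containing a t
... | L , a∈L , uL , cover , sum≡s = L , uL , cover′ , sum≡s+δ
  where
  cover′ : ∀ τ → bump F a δ τ ≢ + 0 → τ ∈ L
  cover′ τ bump≢0 with τ ≟F a
  ... | yes refl = a∈L
  ... | no _     = cover τ bump≢0
  sum≡s+δ : sumOver L (bump F a δ) ≡ s + δ
  sum≡s+δ = trans (sumOver-bump F a δ uL a∈L) (cong (_+ δ) sum≡s)

gain : ∀ {σ F G} → Step σ F G → ℤ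
gain (fire _ _ _ _ _ _) = + 0
gain (fromσ _ _ _)      = + 1
gain (toσ _ _ _)        = - + 1

-- Every move changes the total by exactly its gain: firing moves one unit
-- between two faces, while σ acts as an unlimited source and sink.
step-total : ∀ {σ F G s} (st : Step σ F G) → Total F s → Total G (s + gain st)
step-total {s = s} (fire a b _ _ _ _) t =
  subst (Total _) (ZP.+-assoc s (- + 1) (+ 1)) (total-bump b (+ 1) (total-bump a (- + 1) t))
step-total (fromσ a _ _) t = total-bump a (+ 1) t
step-total (toσ a _ _)   t = total-bump a (- + 1) t

offsets : ℕ → List ℤ
offsets zero    = + 0 ∷ []
offsets (suc k) = + suc k ∷ -[1+ k ] ∷ offsets k

offsets-complete : ∀ k z → ∣ z ∣ N.≤ k → z ∈ offsets k
offsets-complete zero    (+ zero)   _ = here refl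
offsets-complete (suc k) (+ zero)   _ = there (there (offsets-complete k (+ zero) z≤n))
offsets-complete (suc k) (+ suc n)  (s≤s n≤k) with n N.≟ k
... | yes refl = here refl
... | no  n≢k  = there (there (offsets-complete k (+ suc n) (NP.≤∧≢⇒< n≤k n≢k)))
offsets-complete (suc k) -[1+ n ]   (s≤s n≤k) with n N.≟ k
... | yes refl = there (here refl)
... | no  n≢k  = there (there (offsets-complete k -[1+ n ] (NP.≤∧≢⇒< n≤k n≢k)))

window : ℤ → ℕ → List ℤ
window c k = map (λ z → c + z) (offsets k)

window-complete : ∀ c k x → ∣ x - c ∣ N.≤ k → x ∈ window c k
window-complete c k x le =
  subst (_∈ window c k) (c+[x-c]≡x c x) (∈-map⁺ (λ z → c + z) (offsets-complete k (x - c) le))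
  where
  c+[x-c]≡x : ∀ c x → c + (x - c) ≡ x
  c+[x-c]≡x = solve-∀

box : Face → ℕ → List Face
box (cx , cy) k = cartesianProduct (window cx k) (window cy k)

box-complete : ∀ σ k τ → dist τ σ N.≤ k → τ ∈ box σ k
box-complete (cx , cy) k (x , y) le =
  ∈-cartesianProduct⁺ (window-complete cx k x (NP.m+n≤o⇒m≤o (∣ x - cx ∣) le))
                      (window-complete cy k y (NP.m+n≤o⇒n≤o (∣ x - cx ∣) le))

-- The box without repetitions: a common witness list for all reachable totals.
region : Face → ℕ → List Face
region σ k = deduplicate _≟F_ (box σ k)

data Admissible (k d : ℕ) : ℤ → Set where
  vacant   : Admissible k d (+ 0)
  occupied : ∀ {m} → m N.≤ k → d N.+ m N.≤ suc k → Admissible k d (+ m)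

admissible-nonneg : ∀ {k d i} → Admissible k d i → + 0 ≤ i
admissible-nonneg vacant         = +≤+ z≤n
admissible-nonneg (occupied _ _) = +≤+ z≤n

admissible-≤ : ∀ {k d i} → Admissible k d i → i ≤ + k
admissible-≤ vacant            = +≤+ z≤n
admissible-≤ (occupied m≤k _) = +≤+ m≤k

admissible-near : ∀ {k d i} → Admissible k d i → i ≢ + 0 → d N.≤ k
admissible-near vacant i≢0 = contradiction refl i≢0
admissible-near (occupied {zero} _ _) i≢0 = contradiction refl i≢0
admissible-near {k} {d} (occupied {suc m} _ d+m<k+1) _ =
  NP.m+n≤o⇒m≤o d (NP.≤-pred (subst (N._≤ suc k) (NP.+-suc d m) d+m<k+1))

admissible-give : ∀ {k d i} → Admissible k d i → + 1 ≤ i → Admissible k d (i - + 1)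
admissible-give vacant (+≤+ ())
admissible-give (occupied {zero} _ _) (+≤+ ())
admissible-give {d = d} (occupied {suc m} m<k d+m<k+1) _ =
  occupied (NP.<⇒≤ m<k) (NP.≤-trans (NP.+-monoʳ-≤ d (NP.n≤1+n m)) d+m<k+1)

receive-bound : ∀ {k d d′ i} m → d′ N.≤ suc d → Admissible k d i →
                + (m N.+ 2) ≤ i → Admissible k d′ (+ (m N.+ 1))
receive-bound m _ vacant (+≤+ m+2≤0) = contradiction (NP.m+n≤o⇒n≤o m m+2≤0) λ ()
receive-bound {k} {d} {d′} m d′≤d+1 (occupied {n} n≤k d+n≤k+1) (+≤+ m+2≤n) =
  occupied (NP.≤-trans (NP.+-monoʳ-≤ m (NP.n≤1+n 1)) (NP.≤-trans m+2≤n n≤k)) bound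
  where
  open NP.≤-Reasoning
  bound : d′ N.+ (m N.+ 1) N.≤ suc k
  bound = begin
    d′ N.+ (m N.+ 1)      ≤⟨ NP.+-monoˡ-≤ (m N.+ 1) d′≤d+1 ⟩
    suc d N.+ (m N.+ 1)   ≡⟨ NP.+-suc d (m N.+ 1) ⟨
    d N.+ suc (m N.+ 1)   ≡⟨ cong (d N.+_) (NP.+-suc m 1) ⟨
    d N.+ (m N.+ 2)       ≤⟨ NP.+-monoʳ-≤ d m+2≤n ⟩
    d N.+ n               ≤⟨ d+n≤k+1 ⟩
    suc k                 ∎

admissible-receive : ∀ {k d d′ i j} → d′ N.≤ suc d → Admissible k d i →
                     Admissible k d′ j → j + + 2 ≤ i → Admissible k d′ (j + + 1)
admissible-receive d′≤d+1 i-adm vacant           j+2≤i = receive-bound 0 d′≤d+1 i-adm j+2≤i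
admissible-receive d′≤d+1 i-adm (occupied {m} _ _) j+2≤i = receive-bound m d′≤d+1 i-adm j+2≤i


feed-bound : ∀ {k d} m → d N.≤ 1 → m N.< k → Admissible k d (+ (m N.+ 1))
feed-bound {k} m d≤1 m<k = occupied m+1≤k (NP.+-mono-≤ d≤1 m+1≤k)
  where
  m+1≤k : m N.+ 1 N.≤ k
  m+1≤k = subst (N._≤ k) (NP.+-comm 1 m) m<k

admissible-feed : ∀ {k d i} → d N.≤ 1 → Admissible k d i → i < + k → Admissible k d (i + + 1)
admissible-feed d≤1 vacant             (+<+ 0<k) = feed-bound 0 d≤1 0<k
admissible-feed d≤1 (occupied {m} _ _) (+<+ m<k) = feed-bound m d≤1 m<k

record Invariant (σ : Face) (k : ℕ) (F : Config) : Set where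
  field
    centre     : F σ ≡ + k
    admissible : ∀ τ → Admissible k (dist τ σ) (F τ)

open Invariant

initial-invariant : ∀ σ k → Invariant σ k (initial σ k)
initial-invariant σ k .centre with σ ≟F σ
... | yes _   = refl
... | no σ≢σ  = contradiction refl σ≢σ
initial-invariant σ k .admissible τ with τ ≟F σ
... | yes refl = occupied NP.≤-refl (subst (λ d → d N.+ k N.≤ suc k) (sym (dist-self σ)) (NP.n≤1+n k))
... | no _     = vacant

invariant-nonneg : ∀ {σ k F} → Invariant σ k F → ∀ τ → + 0 ≤ F τ
invariant-nonneg inv τ = admissible-nonneg (admissible inv τ)

-- No neighbour of σ exceeds σ, so moves towards σ never occur.
no-move-to-σ : ∀ {σ k F} a → Invariant σ k F → ¬ (F σ < F a)
no-move-to-σ {F = F} a inv Fσ<Fa =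
  ZP.<⇒≱ Fσ<Fa (subst (F a ≤_) (sym (centre inv)) (admissible-≤ (admissible inv a)))

step-invariant : ∀ {σ k F G} → Invariant σ k F → Step σ F G → Invariant σ k G
step-invariant {σ} {k} {F} inv (fire a b adj a≢σ b≢σ Fb+2≤Fa) = record
  { centre     = trans (bump-there F′ b (+ 1) σ (≢-sym b≢σ))
                       (trans (bump-there F a (- + 1) σ (≢-sym a≢σ)) (centre inv))
  ; admissible = bump-pointwise P F′ b (+ 1) b-gains (λ τ _ → after-a-gives τ)
  }
  where
  P : Face → ℤ → Set
  P τ = Admissible k (dist τ σ)
  F′ : Config
  F′ = bump F a (- + 1)
  1≤Fa : + 1 ≤ F a
  1≤Fa = ZP.≤-trans (+≤+ (s≤s z≤n))
           (ZP.≤-trans (ZP.+-monoˡ-≤ (+ 2) (invariant-nonneg inv b)) Fb+2≤Fa)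
  after-a-gives : ∀ τ → P τ (F′ τ)
  after-a-gives = bump-pointwise P F a (- + 1) (admissible-give (admissible inv a) 1≤Fa)
                    (λ τ _ → admissible inv τ)
  b-gains : P b (F′ b + + 1)
  b-gains = subst (λ v → P b (v + + 1)) (sym (bump-there F a (- + 1) b (≢-sym (adj⇒≢ a b adj))))
              (admissible-receive (dist-adj a b σ adj) (admissible inv a) (admissible inv b) Fb+2≤Fa)
step-invariant {σ} {k} {F} inv (fromσ a adj Fa<Fσ) = record
  { centre     = trans (bump-there F a (+ 1) σ (≢-sym (adj⇒≢ a σ adj))) (centre inv)
  ; admissible = bump-pointwise (λ τ → Admissible k (dist τ σ)) F a (+ 1) a-fed
                   (λ τ _ → admissible inv τ)
  }
  where
  a-fed : Admissible k (dist a σ) (F a + + 1)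
  a-fed = admissible-feed (NP.≤-reflexive adj) (admissible inv a)
            (subst (F a <_) (centre inv) Fa<Fσ)
step-invariant inv (toσ a _ Fσ<Fa) = contradiction Fσ<Fa (no-move-to-σ a inv)

invariant-star : ∀ {σ k F G} → Invariant σ k F → Star (Step σ) F G → Invariant σ k G
invariant-star inv ε          = inv
invariant-star inv (st ◅ run) = invariant-star (step-invariant inv st) run

reachable-invariant : ∀ {σ k F} → Reachable σ (initial σ k) F → Invariant σ k F
reachable-invariant {σ} {k} = invariant-star (initial-invariant σ k)

gain-nonneg : ∀ {σ k F G} → Invariant σ k F → (st : Step σ F G) → + 0 ≤ gain st
gain-nonneg _   (fire _ _ _ _ _ _)  = +≤+ z≤n
gain-nonneg _   (fromσ _ _ _)       = +≤+ z≤n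
gain-nonneg inv (toσ a _ Fσ<Fa)     = contradiction Fσ<Fa (no-move-to-σ a inv)

region-total : ∀ {σ k F} → Invariant σ k F → TotalOn (region σ k) F (sumOver (region σ k) F)
region-total {σ} {k} inv =
  deduplicate-! (box σ k) ,
  (λ τ Fτ≢0 → ∈-deduplicate⁺ _≟F_ (box-complete σ k τ (admissible-near (admissible inv τ) Fτ≢0))) ,
  refl

total-bounded : ∀ {σ k F s} → Invariant σ k F → Total F s → s ≤ + (k N.* length (region σ k))
total-bounded {σ} {k} {F} inv t =
  subst (_≤ + (k N.* length (region σ k)))
        (total-unique (invariant-nonneg inv) (region σ k , region-total inv) t)
        (sumOver-bounded k (λ τ → admissible-≤ (admissible inv τ)) (region σ k))

proposition6p3 : (σ : Face) (k : ℕ) →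
    ((K* : Config) → Reachable σ (initial σ k) K* → ∀ τ → + 0 ≤ K* τ)
    × ((∀ (K* : Config) → Reachable σ (initial σ k) K* → ∃ λ s → Total K* s)
    × (Σ ℤ λ B → ∀ (K* : Config) → Reachable σ (initial σ k) K* →
          ∀ s → Total K* s → s ≤ B)
    × (∀ (K₁ K₂ : Config) → Reachable σ (initial σ k) K₁ → Step σ K₁ K₂ →
          ∀ s₁ s₂ → Total K₁ s₁ → Total K₂ s₂ → s₁ ≤ s₂))
proposition6p3 σ k =
    (λ _ reach → invariant-nonneg (reachable-invariant reach))
  , (λ _ reach → _ , region σ k , region-total (reachable-invariant reach))
  , (+ (k N.* length (region σ k)) , λ _ reach _ t → total-bounded (reachable-invariant reach) t)
  , nondecreasing
  where
  nondecreasing : ∀ K₁ K₂ → Reachable σ (initial σ k) K₁ → Step σ K₁ K₂ →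
                  ∀ s₁ s₂ → Total K₁ s₁ → Total K₂ s₂ → s₁ ≤ s₂
  nondecreasing K₁ K₂ reach st s₁ s₂ t₁ t₂ = begin
    s₁             ≡⟨ ZP.+-identityʳ s₁ ⟨
    s₁ + + 0       ≤⟨ ZP.+-monoʳ-≤ s₁ (gain-nonneg inv₁ st) ⟩
    s₁ + gain st   ≡⟨ total-unique (invariant-nonneg inv₂) (step-total st t₁) t₂ ⟩
    s₂             ∎
    where
    open ZP.≤-Reasoning
    inv₁ : Invariant σ k K₁
    inv₁ = reachable-invariant reach
    inv₂ : Invariant σ k K₂
    inv₂ = step-invariant inv₁ st
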